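{- Let $\Gamma$ be a finite-type Dynkin diagram with vertices indexed $1,\dots,n$ and Cartan matrix $\mathsf{C}$. Let $F$ be a positive integral frieze of type $\Gamma$, and let $p\geq 1$ be an integer such that $F_{i,k+p}=F_{i,k}$ for all $i\in\{1,\dots,n\}$ and $k\in\mathbb{Z}$. Define the vector $\vec{\mathbf{a}}(F)\in\mathbb{R}^n$ by \[ a_i(F):=\frac{1}{p}\sum_{k=1}^p \log_2(F_{i,k}). \] Then every entry of the product $\mathsf{C}\,\vec{\mathbf{a}}(F)$ lies in the half-open interval $(0,1]$.
   Context: $\Gamma$ is a finite-type (not necessarily simply-laced) Dynkin diagram with vertices indexed $1,\dots,n$, and $\mathsf{C}=(\mathsf{C}_{i,j})$ is its Cartan matrix (so $\mathsf{C}_{i,i}=2$ and $\mathsf{C}_{i,j}\le 0$ for $i\ne j$). A positive integral frieze of type $\Gamma$ is a function $F:\{1,\dots,n\}\times\mathbb{Z}\to\mathbb{Z}_{\geq 1}$, $(i,k)\mapsto F_{i,k}$, satisfying the mesh relations: for every $(i,k)\in\{1,\dots,n\}\times\mathbb{Z}$, \[ F_{i,k}F_{i,k+1}=1+\prod_{j<i}F_{j,k}^{ -\mathsf{C}_{i,j}}\prod_{j>i}F_{j,k+1}^{ -\mathsf{C}_{i,j}}. \] (It is known that every such frieze is periodic in $k$ for some period $p$.) -}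

module Defs where

open import Data.Nat using (ℕ; zero; suc; _+_; _*_; _∸_; _^_; _≡ᵇ_; _<ᵇ_)
open import Data.Bool using (Bool; true; false; if_then_else_; _∧_; _∨_)
open import Data.Integer as ℤ using (ℤ; +_; -[1+_])
open import Data.Fin using (Fin; toℕ; _<_; _>_)
import Data.Fin as Fin
open import Data.Fin.Permutation using (Permutation′; _⟨$⟩ʳ_)
open import Data.Product using (Σ; _×_)
open import Relation.Binary.PropositionalEquality using (_≡_)
open import Relation.Nullary using (Dec; yes; no)

data DynkinType : Set where
  A : ℕ → DynkinType   -- A m  is A_{m+1}  (rank ≥ 1)
  B : ℕ → DynkinType   -- B m  is B_{m+2}  (rank ≥ 2)
  C : ℕ → DynkinType   -- C m  is C_{m+2}  (rank ≥ 2)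
  D : ℕ → DynkinType   -- D m  is D_{m+4}  (rank ≥ 4)
  E6 E7 E8 F4 G2 : DynkinType

rank : DynkinType → ℕ
rank (A m) = suc m
rank (B m) = 2 + m
rank (C m) = 2 + m
rank (D m) = 4 + m
rank E6 = 6
rank E7 = 7
rank E8 = 8
rank F4 = 4
rank G2 = 2

chainEdge : ℕ → ℕ → ℕ → Bool
chainEdge L i j = ((suc i ≡ᵇ j) ∨ (suc j ≡ᵇ i)) ∧ (i <ᵇ L) ∧ (j <ᵇ L)

pairIs : ℕ → ℕ → ℕ → ℕ → Bool
pairIs a b i j = ((i ≡ᵇ a) ∧ (j ≡ᵇ b)) ∨ ((i ≡ᵇ b) ∧ (j ≡ᵇ a))

one? : Bool → ℕ
one? b = if b then 1 else 0

-- bond T i j = - C_{ij} of the standard Cartan matrix of type T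
-- for i ≠ j (vertices labelled 0 .. rank T - 1)
bond : DynkinType → ℕ → ℕ → ℕ
bond (A m) i j = one? (chainEdge (suc m) i j)
bond (B m) i j =
  if (i ≡ᵇ m) ∧ (j ≡ᵇ suc m) then 2 else one? (chainEdge (2 + m) i j)
bond (C m) i j =
  if (j ≡ᵇ m) ∧ (i ≡ᵇ suc m) then 2 else one? (chainEdge (2 + m) i j)
bond (D m) i j = one? (chainEdge (3 + m) i j ∨ pairIs (1 + m) (3 + m) i j)
bond E6 i j = one? (chainEdge 5 i j ∨ pairIs 2 5 i j)
bond E7 i j = one? (chainEdge 6 i j ∨ pairIs 2 6 i j)
bond E8 i j = one? (chainEdge 7 i j ∨ pairIs 2 7 i j)
bond F4 i j = if (i ≡ᵇ 1) ∧ (j ≡ᵇ 2) then 2 else one? (chainEdge 4 i j)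
bond G2 i j = if (i ≡ᵇ 0) ∧ (j ≡ᵇ 1) then 3 else one? (chainEdge 2 i j)

stdCartan : DynkinType → ℕ → ℕ → ℤ
stdCartan T i j = if i ≡ᵇ j then + 2 else ℤ.- (+ bond T i j)

-- C is the Cartan matrix of a (connected) finite-type Dynkin diagram
-- with its vertices indexed (in an arbitrary way) by Fin n.
IsFiniteTypeCartan : (n : ℕ) → (Fin n → Fin n → ℤ) → Set
IsFiniteTypeCartan n Cm =
  Σ DynkinType λ T → (rank T ≡ n) ×
    Σ (Permutation′ n) λ σ →
      ∀ i j → Cm i j ≡ stdCartan T (toℕ (σ ⟨$⟩ʳ i)) (toℕ (σ ⟨$⟩ʳ j))

prodFin : (n : ℕ) → (Fin n → ℕ) → ℕ
prodFin zero    f = 1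
prodFin (suc n) f = f Fin.zero * prodFin n (λ j → f (Fin.suc j))

prodFinIf : (n : ℕ) → (Fin n → Bool) → (Fin n → ℕ) → ℕ
prodFinIf n P f = prodFin n (λ j → if P j then f j else 1)

posPart : ℤ → ℕ
posPart (+ m)    = m
posPart -[1+ m ] = 0

negPart : ℤ → ℕ
negPart (+ m)    = 0
negPart -[1+ m ] = suc m

prodRange : ℕ → (ℤ → ℕ) → ℕ
prodRange zero    f = 1
prodRange (suc p) f = prodRange p f * f (+ suc p)

lessB : {n : ℕ} → Fin n → Fin n → Bool
lessB j i = toℕ j <ᵇ toℕ i

-- Positive integral frieze of type C (values in ℤ≥1, represented in ℕ)
IsPositiveIntegralFrieze : (n : ℕ) → (Fin n → Fin n → ℤ) → (Fin n → ℤ → ℕ) → Set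
IsPositiveIntegralFrieze n Cm F =
  (∀ i k → 1 Data.Nat.≤ F i k) ×
  (∀ i k → F i k * F i (k ℤ.+ + 1) ≡
     1 + prodFinIf n (λ j → lessB j i) (λ j → F j k ^ negPart (Cm i j))
       * prodFinIf n (λ j → lessB i j) (λ j → F j (k ℤ.+ + 1) ^ negPart (Cm i j)))

-- (C a(F))_i = (1/p) log₂ (Num_i / Den_i) where
--   Num_i = ∏_{k=1}^p ∏_j F_{j,k}^{max(C_ij,0)}
--   Den_i = ∏_{k=1}^p ∏_j F_{j,k}^{max(-C_ij,0)}

caNum : (n : ℕ) → (Fin n → Fin n → ℤ) → (Fin n → ℤ → ℕ) → ℕ → Fin n → ℕ
caNum n Cm F p i = prodRange p (λ k → prodFin n (λ j → F j k ^ posPart (Cm i j)))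

caDen : (n : ℕ) → (Fin n → Fin n → ℤ) → (Fin n → ℤ → ℕ) → ℕ → Fin n → ℕ
caDen n Cm F p i = prodRange p (λ k → prodFin n (λ j → F j k ^ negPart (Cm i j)))

{-# OPTIONS --safe #-}
-- Let A_k and B_k be the products of F_{j,k}^{-C_ij} over j < i and over j > i, so that the
-- mesh relation at (i,k) reads F_{i,k} F_{i,k+1} = 1 + M_k with M_k = A_k B_{k+1}. As C_ii = 2
-- and C_ij ≤ 0 for j ≠ i, the numerator is ∏_k F_{i,k}², which by periodicity is
-- ∏_k F_{i,k} F_{i,k+1} = ∏_k (1 + M_k); splitting the denominator at the diagonal gives
-- ∏_k A_k B_k, which by periodicity is ∏_k M_k. Both bounds then follow from
-- M_k < 1 + M_k ≤ 2 M_k, valid because M_k ≥ 1.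
module Submission where

open import Defs
open import Data.Nat using (ℕ; _≤_; _<_; _*_; _^_)
open import Data.Integer using (ℤ; +_; _+_)
open import Data.Fin using (Fin)
open import Data.Product using (_×_)
open import Relation.Binary.PropositionalEquality using (_≡_)

open import Data.Bool using (Bool; true; false; if_then_else_)
open import Data.Empty using (⊥-elim)
import Data.Fin as Fin
open import Data.Fin.Permutation using (_⟨$⟩ʳ_)
import Data.Fin.Properties as Finₚ
import Data.Integer as ℤ
import Data.Nat as ℕ
open import Data.Nat using (zero; suc; _≡ᵇ_; z≤n; s≤s; NonZero; >-nonZero)
open import Data.Nat.Properties
open import Algebra.Properties.CommutativeSemigroup *-commutativeSemigroup using (interchange)
open import Data.Product using (_,_)
open import Function.Base using (_∘_)
open import Function.Bundles using (Injection)
open import Function.Properties.Inverse using (↔⇒↣)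
open import Relation.Nullary.Reflects using (ofʸ; ofⁿ)
open import Relation.Binary.PropositionalEquality
  using (refl; sym; trans; cong; cong₂; subst₂; _≢_; module ≡-Reasoning)

prodFin-cong : ∀ n {f g : Fin n → ℕ} → (∀ j → f j ≡ g j) → prodFin n f ≡ prodFin n g
prodFin-cong zero    f≡g = refl
prodFin-cong (suc n) f≡g = cong₂ _*_ (f≡g Fin.zero) (prodFin-cong n (f≡g ∘ Fin.suc))

prodFin-* : ∀ n (f g : Fin n → ℕ) → prodFin n (λ j → f j * g j) ≡ prodFin n f * prodFin n g
prodFin-* zero    f g = refl
prodFin-* (suc n) f g = begin
  f Fin.zero * g Fin.zero * prodFin n (λ j → f (Fin.suc j) * g (Fin.suc j))
    ≡⟨ cong (f Fin.zero * g Fin.zero *_) (prodFin-* n (f ∘ Fin.suc) (g ∘ Fin.suc)) ⟩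
  f Fin.zero * g Fin.zero * (prodFin n (f ∘ Fin.suc) * prodFin n (g ∘ Fin.suc))
    ≡⟨ interchange (f Fin.zero) (g Fin.zero) _ _ ⟩
  f Fin.zero * prodFin n (f ∘ Fin.suc) * (g Fin.zero * prodFin n (g ∘ Fin.suc))
    ∎
  where open ≡-Reasoning

prodFin-pos : ∀ n {f : Fin n → ℕ} → (∀ j → 0 < f j) → 0 < prodFin n f
prodFin-pos zero    f>0 = s≤s z≤n
prodFin-pos (suc n) f>0 = *-mono-≤ (f>0 Fin.zero) (prodFin-pos n (f>0 ∘ Fin.suc))

prodFin-ones : ∀ n {f : Fin n → ℕ} → (∀ j → f j ≡ 1) → prodFin n f ≡ 1
prodFin-ones zero    f≡1 = refl
prodFin-ones (suc n) f≡1 = cong₂ _*_ (f≡1 Fin.zero) (prodFin-ones n (f≡1 ∘ Fin.suc))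

prodFin-single : ∀ n (f : Fin n → ℕ) i → (∀ j → j ≢ i → f j ≡ 1) → prodFin n f ≡ f i
prodFin-single (suc n) f Fin.zero f≡1 = begin
  f Fin.zero * prodFin n (f ∘ Fin.suc) ≡⟨ cong (f Fin.zero *_) (prodFin-ones n (λ j → f≡1 (Fin.suc j) λ ())) ⟩
  f Fin.zero * 1                       ≡⟨ *-identityʳ _ ⟩
  f Fin.zero                           ∎
  where open ≡-Reasoning
prodFin-single (suc n) f (Fin.suc i) f≡1 = begin
  f Fin.zero * prodFin n (f ∘ Fin.suc) ≡⟨ cong (_* prodFin n (f ∘ Fin.suc)) (f≡1 Fin.zero λ ()) ⟩
  1 * prodFin n (f ∘ Fin.suc)          ≡⟨ *-identityˡ _ ⟩
  prodFin n (f ∘ Fin.suc)              ≡⟨ prodFin-single n _ i (λ j j≢i → f≡1 (Fin.suc j) (j≢i ∘ Finₚ.suc-injective)) ⟩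
  f (Fin.suc i)                        ∎
  where open ≡-Reasoning

prodFinIf-pos : ∀ n (P : Fin n → Bool) {f : Fin n → ℕ} → (∀ j → 0 < f j) → 0 < prodFinIf n P f
prodFinIf-pos n P {f} f>0 = prodFin-pos n guarded>0
  where
  guarded>0 : ∀ j → 0 < (if P j then f j else 1)
  guarded>0 j with P j
  ... | true  = f>0 j
  ... | false = s≤s z≤n

lessB-split : ∀ {n} (i j : Fin n) {x : ℕ} → (j ≡ i → x ≡ 1) →
              x ≡ (if lessB j i then x else 1) * (if lessB i j then x else 1)
lessB-split i j {x} x≡1
  with lessB j i | <ᵇ-reflects-< (Fin.toℕ j) (Fin.toℕ i)
     | lessB i j | <ᵇ-reflects-< (Fin.toℕ i) (Fin.toℕ j)
... | true  | ofʸ j<i | true  | ofʸ i<j = ⊥-elim (<-asym j<i i<j)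
... | true  | _       | false | _       = sym (*-identityʳ x)
... | false | _       | true  | _       = sym (*-identityˡ x)
... | false | ofⁿ j≮i | false | ofⁿ i≮j = x≡1 (Finₚ.toℕ-injective (≤-antisym (≮⇒≥ i≮j) (≮⇒≥ j≮i)))

prodFin-splitAt : ∀ n (f : Fin n → ℕ) i → f i ≡ 1 →
                  prodFin n f ≡ prodFinIf n (λ j → lessB j i) f * prodFinIf n (λ j → lessB i j) f
prodFin-splitAt n f i fi≡1 = trans
  (prodFin-cong n (λ j → lessB-split i j λ { refl → fi≡1 }))
  (prodFin-* n _ _)

prodRange-cong : ∀ p {f g : ℤ → ℕ} → (∀ k → f k ≡ g k) → prodRange p f ≡ prodRange p g
prodRange-cong zero    f≡g = refl
prodRange-cong (suc p) f≡g = cong₂ _*_ (prodRange-cong p f≡g) (f≡g _)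

prodRange-* : ∀ p (f g : ℤ → ℕ) → prodRange p (λ k → f k * g k) ≡ prodRange p f * prodRange p g
prodRange-* zero    f g = refl
prodRange-* (suc p) f g = begin
  prodRange p (λ k → f k * g k) * (f (+ suc p) * g (+ suc p))
    ≡⟨ cong (_* (f (+ suc p) * g (+ suc p))) (prodRange-* p f g) ⟩
  prodRange p f * prodRange p g * (f (+ suc p) * g (+ suc p))
    ≡⟨ interchange (prodRange p f) _ _ _ ⟩
  prodRange p f * f (+ suc p) * (prodRange p g * g (+ suc p))
    ∎
  where open ≡-Reasoning

prodRange-const : ∀ p c → prodRange p (λ _ → c) ≡ c ^ p
prodRange-const zero    c = refl
prodRange-const (suc p) c = trans (cong (_* c) (prodRange-const p c)) (*-comm (c ^ p) c)

prodRange-pos : ∀ p {f : ℤ → ℕ} → (∀ k → 0 < f k) → 0 < prodRange p f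
prodRange-pos zero    f>0 = s≤s z≤n
prodRange-pos (suc p) f>0 = *-mono-≤ (prodRange-pos p f>0) (f>0 _)

prodRange-mono-≤ : ∀ p {f g : ℤ → ℕ} → (∀ k → f k ≤ g k) → prodRange p f ≤ prodRange p g
prodRange-mono-≤ zero    f≤g = ≤-refl
prodRange-mono-≤ (suc p) f≤g = *-mono-≤ (prodRange-mono-≤ p f≤g) (f≤g _)

prodRange-mono-< : ∀ {p} {f g : ℤ → ℕ} → 0 < p → (∀ k → f k < g k) → prodRange p f < prodRange p g
prodRange-mono-< {suc p} {f} {g} _ f<g = begin-strict
  prodRange p f * f (+ suc p) ≤⟨ *-monoˡ-≤ (f (+ suc p)) (prodRange-mono-≤ p (<⇒≤ ∘ f<g)) ⟩
  prodRange p g * f (+ suc p) <⟨ *-monoʳ-< (prodRange p g) {{g≢0}} (f<g _) ⟩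
  prodRange p g * g (+ suc p) ∎
  where
  open ≤-Reasoning
  g≢0 : NonZero (prodRange p g)
  g≢0 = >-nonZero (prodRange-pos p (m<n⇒0<n ∘ f<g))

prodRange-suc-head : ∀ p (g : ℤ → ℕ) → prodRange (suc p) g ≡ g (+ 1) * prodRange p (λ k → g (k + + 1))
prodRange-suc-head zero    g = trans (*-identityˡ _) (sym (*-identityʳ _))
prodRange-suc-head (suc p) g = begin
  prodRange (suc p) g * g (+ suc (suc p))
    ≡⟨ cong (_* g (+ suc (suc p))) (prodRange-suc-head p g) ⟩
  g (+ 1) * prodRange p (λ k → g (k + + 1)) * g (+ suc (suc p))
    ≡⟨ *-assoc (g (+ 1)) _ _ ⟩
  g (+ 1) * (prodRange p (λ k → g (k + + 1)) * g (+ suc (suc p)))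
    ≡⟨ cong (λ m → g (+ 1) * (prodRange p (λ k → g (k + + 1)) * g (+ m))) (+-comm 1 (suc p)) ⟩
  g (+ 1) * prodRange (suc p) (λ k → g (k + + 1))
    ∎
  where open ≡-Reasoning

prodRange-shift : ∀ p (g : ℤ → ℕ) → g (+ suc p) ≡ g (+ 1) →
                  prodRange p (λ k → g (k + + 1)) ≡ prodRange p g
prodRange-shift zero    g _        = refl
prodRange-shift (suc p) g periodic = begin
  shifted * g (+ suc p + + 1) ≡⟨ cong (λ m → shifted * g (+ m)) (+-comm (suc p) 1) ⟩
  shifted * g (+ suc (suc p)) ≡⟨ cong (shifted *_) periodic ⟩
  shifted * g (+ 1)           ≡⟨ *-comm shifted (g (+ 1)) ⟩
  g (+ 1) * shifted           ≡⟨ prodRange-suc-head p g ⟨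
  prodRange (suc p) g         ∎
  where
  open ≡-Reasoning
  shifted : ℕ
  shifted = prodRange p (λ k → g (k + + 1))

prodRange-*-shift : ∀ p (f g : ℤ → ℕ) → g (+ suc p) ≡ g (+ 1) →
                    prodRange p (λ k → f k * g (k + + 1)) ≡ prodRange p (λ k → f k * g k)
prodRange-*-shift p f g periodic = begin
  prodRange p (λ k → f k * g (k + + 1))           ≡⟨ prodRange-* p f _ ⟩
  prodRange p f * prodRange p (λ k → g (k + + 1)) ≡⟨ cong (prodRange p f *_) (prodRange-shift p g periodic) ⟩
  prodRange p f * prodRange p g                   ≡⟨ prodRange-* p f g ⟨
  prodRange p (λ k → f k * g k)                   ∎
  where open ≡-Reasoning

prodRange-suc≤2^* : ∀ p {f : ℤ → ℕ} → (∀ k → 0 < f k) →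
                    prodRange p (λ k → suc (f k)) ≤ 2 ^ p * prodRange p f
prodRange-suc≤2^* p {f} f>0 = begin
  prodRange p (λ k → suc (f k))         ≤⟨ prodRange-mono-≤ p suc≤2* ⟩
  prodRange p (λ k → 2 * f k)           ≡⟨ prodRange-* p (λ _ → 2) f ⟩
  prodRange p (λ _ → 2) * prodRange p f ≡⟨ cong (_* prodRange p f) (prodRange-const p 2) ⟩
  2 ^ p * prodRange p f                 ∎
  where
  open ≤-Reasoning
  suc≤2* : ∀ k → suc (f k) ≤ 2 * f k
  suc≤2* k = ≤-trans (+-monoˡ-≤ (f k) (f>0 k)) (≤-reflexive (cong (f k ℕ.+_) (sym (+-identityʳ (f k)))))

stdCartan-diag : ∀ T x → stdCartan T x x ≡ + 2
stdCartan-diag T x with x ≡ᵇ x | ≡⇒≡ᵇ x x refl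
... | true  | _ = refl
... | false | ()

posPart-neg : ∀ b → posPart (ℤ.- (+ b)) ≡ 0
posPart-neg zero    = refl
posPart-neg (suc b) = refl

stdCartan-posPart-offDiag : ∀ T {x y} → x ≢ y → posPart (stdCartan T x y) ≡ 0
stdCartan-posPart-offDiag T {x} {y} x≢y with x ≡ᵇ y | ≡ᵇ⇒≡ x y
... | true  | x≡y = ⊥-elim (x≢y (x≡y _))
... | false | _   = posPart-neg (bond T x y)

cartan-diag : ∀ {n Cm} → IsFiniteTypeCartan n Cm → ∀ i → Cm i i ≡ + 2
cartan-diag (T , _ , _ , Cm≡) i = trans (Cm≡ i i) (stdCartan-diag T _)

cartan-posPart-offDiag : ∀ {n Cm} → IsFiniteTypeCartan n Cm → ∀ i j → j ≢ i → posPart (Cm i j) ≡ 0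
cartan-posPart-offDiag (T , _ , σ , Cm≡) i j j≢i =
  trans (cong posPart (Cm≡ i j)) (stdCartan-posPart-offDiag T σi≢σj)
  where
  σi≢σj : Fin.toℕ (σ ⟨$⟩ʳ i) ≢ Fin.toℕ (σ ⟨$⟩ʳ j)
  σi≢σj = j≢i ∘ sym ∘ Injection.injective (↔⇒↣ σ) ∘ Finₚ.toℕ-injective

module MeshRow {n} (Cm : Fin n → Fin n → ℤ) (F : Fin n → ℤ → ℕ) (i : Fin n) where

  lowerMesh upperMesh meshProduct : ℤ → ℕ
  lowerMesh k   = prodFinIf n (λ j → lessB j i) (λ j → F j k ^ negPart (Cm i j))
  upperMesh k   = prodFinIf n (λ j → lessB i j) (λ j → F j k ^ negPart (Cm i j))
  meshProduct k = lowerMesh k * upperMesh (k + + 1)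

  meshProduct-pos : (∀ j k → 0 < F j k) → ∀ k → 0 < meshProduct k
  meshProduct-pos F>0 k = *-mono-≤ (prodFinIf-pos n _ (F^d>0 k)) (prodFinIf-pos n _ (F^d>0 (k + + 1)))
    where
    F^d>0 : ∀ k j → 0 < F j k ^ negPart (Cm i j)
    F^d>0 k j = m^n>0 (F j k) {{>-nonZero (F>0 j k)}} (negPart (Cm i j))

  caDen≡prodRange-meshProduct : ∀ p → Cm i i ≡ + 2 → (∀ j → F j (+ suc p) ≡ F j (+ 1)) →
                                caDen n Cm F p i ≡ prodRange p meshProduct
  caDen≡prodRange-meshProduct p Cii≡2 periodic = begin
    caDen n Cm F p i                              ≡⟨ prodRange-cong p splitRow ⟩
    prodRange p (λ k → lowerMesh k * upperMesh k) ≡⟨ prodRange-*-shift p lowerMesh upperMesh upperPeriodic ⟨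
    prodRange p meshProduct                       ∎
    where
    open ≡-Reasoning
    splitRow : ∀ k → prodFin n (λ j → F j k ^ negPart (Cm i j)) ≡ lowerMesh k * upperMesh k
    splitRow k = prodFin-splitAt n _ i (cong (λ c → F i k ^ negPart c) Cii≡2)
    upperPeriodic : upperMesh (+ suc p) ≡ upperMesh (+ 1)
    upperPeriodic = prodFin-cong n (λ j → cong (λ x → if lessB i j then x ^ negPart (Cm i j) else 1) (periodic j))

  caNum≡prodRange-suc-meshProduct :
    ∀ p → Cm i i ≡ + 2 → (∀ j → j ≢ i → posPart (Cm i j) ≡ 0) →
    (∀ k → F i k * F i (k + + 1) ≡ suc (meshProduct k)) → F i (+ suc p) ≡ F i (+ 1) →
    caNum n Cm F p i ≡ prodRange p (λ k → suc (meshProduct k))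
  caNum≡prodRange-suc-meshProduct p Cii≡2 offDiag⁺≡0 mesh periodic = begin
    caNum n Cm F p i                              ≡⟨ prodRange-cong p diagonalOnly ⟩
    prodRange p (λ k → F i k * F i k)             ≡⟨ prodRange-*-shift p (F i) (F i) periodic ⟨
    prodRange p (λ k → F i k * F i (k + + 1))     ≡⟨ prodRange-cong p mesh ⟩
    prodRange p (λ k → suc (meshProduct k))       ∎
    where
    open ≡-Reasoning
    diagonalOnly : ∀ k → prodFin n (λ j → F j k ^ posPart (Cm i j)) ≡ F i k * F i k
    diagonalOnly k = begin
      prodFin n (λ j → F j k ^ posPart (Cm i j)) ≡⟨ prodFin-single n _ i (λ j j≢i → cong (F j k ^_) (offDiag⁺≡0 j j≢i)) ⟩
      F i k ^ posPart (Cm i i)                   ≡⟨ cong (λ c → F i k ^ posPart c) Cii≡2 ⟩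
      F i k * (F i k * 1)                        ≡⟨ cong (F i k *_) (*-identityʳ (F i k)) ⟩
      F i k * F i k                              ∎

mainTheorem1 : (n : ℕ) (Cm : Fin n → Fin n → ℤ) → IsFiniteTypeCartan n Cm →
    (F : Fin n → ℤ → ℕ) → IsPositiveIntegralFrieze n Cm F →
    (p : ℕ) → 1 ≤ p → (∀ i k → F i (k + + p) ≡ F i k) →
    ∀ i → (caDen n Cm F p i < caNum n Cm F p i) × (caNum n Cm F p i ≤ 2 ^ p * caDen n Cm F p i)
mainTheorem1 n Cm cartan F (F>0 , mesh) p p≥1 periodic i =
    subst₂ _<_ (sym den≡) (sym num≡) (prodRange-mono-< p≥1 (λ k → n<1+n (meshProduct k)))
  , subst₂ (λ num den → num ≤ 2 ^ p * den) (sym num≡) (sym den≡) (prodRange-suc≤2^* p (meshProduct-pos F>0))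
  where
  open MeshRow Cm F i
  num≡ : caNum n Cm F p i ≡ prodRange p (λ k → suc (meshProduct k))
  num≡ = caNum≡prodRange-suc-meshProduct p (cartan-diag cartan i) (cartan-posPart-offDiag cartan i)
           (mesh i) (periodic i (+ 1))
  den≡ : caDen n Cm F p i ≡ prodRange p meshProduct
  den≡ = caDen≡prodRange-meshProduct p (cartan-diag cartan i) (λ j → periodic j (+ 1))
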